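{- Let $G$ be an interval graph and $G_c$ its weighted conflict graph. Then a family $\mathcal{S}=\{S_1,\dots,S_k\}$ of pairwise disjoint cliques of $G$ is a maximum cardinality separated-cluster of $G$ (i.e. $S_1\cup\dots\cup S_k$ is a separated-cluster of maximum size and $S_1,\dots,S_k$ are the vertex sets of the connected components of $G[S_1\cup\dots\cup S_k]$) if and only if $\mathcal{S}\subseteq V(G_c)$ and $\mathcal{S}$ is a maximum weight independent set in $G_c$.
   Context: A separated-cluster of $G$ is a set $S\subseteq V(G)$ with no two vertices at distance exactly $2$ in $G$; then $G[S]$ is a disjoint union of cliques. Fix an interval representation $\{I_v=[l(v),r(v)]\}_{v\in V(G)}$ of $G$. For a maximal clique $C$ and $v,u\in C$, let $C^{lr}(v,u)=\{w\in C: l(w)\ge l(v),\ r(w)\le r(u)\}$; $\hat{\mathcal{C}}$ is the collection of all nonempty such sets over all maximal cliques $C$ and $v,u\in C$. The weighted conflict graph $G_c$ has vertex set $\hat{\mathcal{C}}$, weight $w(K)=|K|$, and distinct $K_i,K_j$ are adjacent iff (a) $K_i\cap K_j\ne\emptyset$, or (b) some $x\in K_i,y\in K_j$ have $xy\in E(G)$, or (c) some $x\in K_i$, $y\in K_j$, $z\in V(G)\setminus(K_i\cup K_j)$ have $x,y\in N_G(z)$. The weight of an independent set is the sum of the weights of its vertices. -}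

module Defs where

open import Data.Nat using (ℕ; _≤_)
open import Data.Fin using (Fin)
open import Data.Fin.Subset using (Subset; _∈_; _∉_; _⊆_; _∪_; _∩_; ⋃; ∣_∣; Nonempty; Empty)
open import Data.List using (List; map)
open import Data.Nat.ListAction using (sum)
open import Data.List.Membership.Propositional using () renaming (_∈_ to _∈ˡ_)
open import Data.List.Relation.Unary.Unique.Propositional using (Unique)
open import Data.Product using (Σ; ∃; ∃-syntax; _×_)
open import Data.Sum using (_⊎_)
open import Relation.Nullary using (¬_)
open import Relation.Binary.PropositionalEquality using (_≡_; _≢_)
open import Function.Bundles using (_⇔_)

-- An interval representation: vertex v ↦ closed interval [l v , r v] (l v ≤ r v).
-- The graph G is the intersection graph of the intervals on vertex set Fin n.
record IntervalRep (n : ℕ) : Set where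
  field
    l     : Fin n → ℕ
    r     : Fin n → ℕ
    l≤r   : ∀ v → l v ≤ r v

module _ {n : ℕ} (I : IntervalRep n) where
  open IntervalRep I

  Adj : Fin n → Fin n → Set
  Adj u v = u ≢ v × l u ≤ r v × l v ≤ r u

  Dist2 : Fin n → Fin n → Set
  Dist2 u v = u ≢ v × ¬ Adj u v × ∃[ z ] (Adj u z × Adj z v)

  IsSeparatedCluster : Subset n → Set
  IsSeparatedCluster S = ∀ u v → u ∈ S → v ∈ S → ¬ Dist2 u v

  IsMaxSeparatedCluster : Subset n → Set
  IsMaxSeparatedCluster S =
    IsSeparatedCluster S × (∀ T → IsSeparatedCluster T → ∣ T ∣ ≤ ∣ S ∣)

  IsClique : Subset n → Set
  IsClique S = ∀ u v → u ∈ S → v ∈ S → u ≢ v → Adj u v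

  IsMaximalClique : Subset n → Set
  IsMaximalClique C = IsClique C × (∀ D → IsClique D → C ⊆ D → D ⊆ C)

  data Reach (X : Subset n) (u : Fin n) : Fin n → Set where
    here : u ∈ X → Reach X u u
    step : ∀ {v w} → Reach X u v → w ∈ X → Adj v w → Reach X u w

  IsConnected : Subset n → Set
  IsConnected X = ∀ u v → u ∈ X → v ∈ X → Reach X u v

  IsComponent : Subset n → Subset n → Set
  IsComponent U X =
    X ⊆ U × Nonempty X × IsConnected X ×
    (∀ Y → X ⊆ Y → Y ⊆ U → IsConnected Y → Y ⊆ X)

  -- K = C^{lr}(v,u) for some maximal clique C and v,u ∈ C, and K nonempty:
  -- i.e. K is a vertex of the conflict graph G_c (an element of Ĉ).
  InĈ : Subset n → Set
  InĈ K =
    ∃[ C ] (IsMaximalClique C × ∃[ v ] ∃[ u ] (v ∈ C × u ∈ C ×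
      (∀ w → (w ∈ K) ⇔ (w ∈ C × l v ≤ l w × r w ≤ r u)))) × Nonempty K

  AdjC : Subset n → Subset n → Set
  AdjC K₁ K₂ = K₁ ≢ K₂ ×
    ( Nonempty (K₁ ∩ K₂)
    ⊎ (∃[ x ] ∃[ y ] (x ∈ K₁ × y ∈ K₂ × Adj x y))
    ⊎ (∃[ x ] ∃[ y ] ∃[ z ] (x ∈ K₁ × y ∈ K₂ × z ∉ (K₁ ∪ K₂) × Adj z x × Adj z y)))

  weight : List (Subset n) → ℕ
  weight 𝒦 = sum (map ∣_∣ 𝒦)

  IsIndepC : List (Subset n) → Set
  IsIndepC 𝒦 = Unique 𝒦 × (∀ K → K ∈ˡ 𝒦 → InĈ K) ×
    (∀ K₁ K₂ → K₁ ∈ˡ 𝒦 → K₂ ∈ˡ 𝒦 → ¬ AdjC K₁ K₂)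

  IsMaxWeightIndepC : List (Subset n) → Set
  IsMaxWeightIndepC 𝒦 =
    IsIndepC 𝒦 × (∀ 𝒯 → IsIndepC 𝒯 → weight 𝒯 ≤ weight 𝒦)

  IsMaxSepClusterFamily : List (Subset n) → Set
  IsMaxSepClusterFamily 𝒮 =
    IsMaxSeparatedCluster (⋃ 𝒮) × (∀ X → (X ∈ˡ 𝒮) ⇔ IsComponent (⋃ 𝒮) X)

  PairwiseDisjointCliques : List (Subset n) → Set
  PairwiseDisjointCliques 𝒮 =
    (∀ S → S ∈ˡ 𝒮 → IsClique S) ×
    (∀ S T → S ∈ˡ 𝒮 → T ∈ˡ 𝒮 → S ≢ T → Empty (S ∩ T))

-- A separated-cluster T splits into the components of G[T], which are cliques closed under
-- adjacency inside T; distinct components cannot be adjacent in G_c, and the weight of the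
-- family equals |T|. Conversely, an independent set of G_c consists of cliques whose union
-- is a separated-cluster with exactly these components. So both problems have the same
-- optimum, provided each component of a separated-cluster that cannot be enlarged is a
-- vertex of G_c. This is where intervals enter: for a component K, take a maximal clique
-- C ⊇ K, let v start first and u end last in K; any interval of C lying between l(v) and
-- r(u) meets nothing that v or u does not, so adding it keeps the cluster separated; by
-- maximality it is then already in K. Hence K = C^{lr}(v,u).
module Submission where

open import Defs
open import Data.Nat using (ℕ; suc; _+_; _≤_; _≤?_)
open import Data.Nat.Properties using (≤-trans; <⇒≤; <⇒≱; ≰⇒>; +-suc)
open import Data.Bool using (true; false)
import Data.Bool as Bool
open import Data.Fin using (Fin; _≟_)
open import Data.Fin.Properties using (all?; any?)
open import Data.Fin.Subset
open import Data.Fin.Subset.Properties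
open import Data.Vec using ([]; _∷_; here; there; tabulate)
open import Data.Vec.Properties using (≡-dec; lookup⇒[]=; []=⇒lookup; lookup∘tabulate)
open import Data.List using (List; []; _∷_; map; filter; allFin; deduplicate; foldl)
open import Data.Nat.ListAction using (sum)
open import Data.List.Membership.Propositional using () renaming (_∈_ to _∈ˡ_)
open import Data.List.Membership.Propositional.Properties
  using (∈-allFin; ∈-filter⁺; ∈-filter⁻; ∈-map⁺; ∈-map⁻; ∈-deduplicate⁺; ∈-deduplicate⁻)
open import Data.List.Relation.Unary.Any using (here; there)
open import Data.List.Relation.Unary.All as All using ()
open import Data.List.Relation.Unary.All.Properties using (all-filter)
open import Data.List.Relation.Unary.AllPairs using (_∷_)
open import Data.List.Relation.Unary.Unique.Propositional using (Unique)
import Data.List.Relation.Unary.Unique.DecPropositional.Properties as Unique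
open import Data.List.Extrema.Nat using (argmin; argmax; argmin-all; argmax-all; f[argmin]≤f[xs]; f[xs]≤f[argmax])
open import Data.Product using (∃-syntax; _×_; _,_; proj₁; proj₂; uncurry)
open import Data.Sum using (_⊎_; inj₁; inj₂; [_,_]′; map₂)
open import Data.Empty using (⊥-elim)
open import Function using (_∘_)
open import Function.Bundles using (_⇔_; mk⇔; Equivalence)
open import Relation.Nullary using (¬_; Dec; yes; no; does)
open import Relation.Nullary.Decidable using (_×-dec_; _→-dec_; ¬?; dec-true)
open import Relation.Unary using (Decidable)
open import Relation.Binary.Definitions using (DecidableEquality)
open import Relation.Binary.PropositionalEquality
  using (_≡_; _≢_; refl; sym; trans; cong; subst; subst₂)
open import Relation.Binary.Construct.Closure.Reflexive using (ReflClosure; refl; [_])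
import Relation.Binary.Construct.Closure.Reflexive.Properties as ReflClosure

_≟ˢ_ : ∀ {n} → DecidableEquality (Subset n)
_≟ˢ_ = ≡-dec Bool._≟_

⊆⋃ : ∀ {n} {𝒦 : List (Subset n)} {K} → K ∈ˡ 𝒦 → K ⊆ ⋃ 𝒦
⊆⋃ (here refl) x∈K = x∈p∪q⁺ (inj₁ x∈K)
⊆⋃ (there K∈𝒦) x∈K = x∈p∪q⁺ (inj₂ (⊆⋃ K∈𝒦 x∈K))

x∈⋃⁻ : ∀ {n} (𝒦 : List (Subset n)) {x} → x ∈ ⋃ 𝒦 → ∃[ K ] (K ∈ˡ 𝒦 × x ∈ K)
x∈⋃⁻ [] x∈⊥ = ⊥-elim (∉⊥ x∈⊥)
x∈⋃⁻ (K ∷ 𝒦) x∈ with x∈p∪q⁻ K (⋃ 𝒦) x∈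
... | inj₁ x∈K = K , here refl , x∈K
... | inj₂ x∈⋃𝒦 with x∈⋃⁻ 𝒦 x∈⋃𝒦
...   | M , M∈𝒦 , x∈M = M , there M∈𝒦 , x∈M

∣p∪q∣≡∣p∣+∣q∣ : ∀ {n} (p q : Subset n) → (∀ {x} → x ∈ p → x ∉ q) → ∣ p ∪ q ∣ ≡ ∣ p ∣ + ∣ q ∣
∣p∪q∣≡∣p∣+∣q∣ [] [] _ = refl
∣p∪q∣≡∣p∣+∣q∣ (true ∷ p) (true ∷ q) disj = ⊥-elim (disj here here)
∣p∪q∣≡∣p∣+∣q∣ (true ∷ p) (false ∷ q) disj =
  cong suc (∣p∪q∣≡∣p∣+∣q∣ p q (λ x∈p x∈q → disj (there x∈p) (there x∈q)))
∣p∪q∣≡∣p∣+∣q∣ (false ∷ p) (true ∷ q) disj =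
  trans (cong suc (∣p∪q∣≡∣p∣+∣q∣ p q (λ x∈p x∈q → disj (there x∈p) (there x∈q))))
        (sym (+-suc ∣ p ∣ ∣ q ∣))
∣p∪q∣≡∣p∣+∣q∣ (false ∷ p) (false ∷ q) disj =
  ∣p∪q∣≡∣p∣+∣q∣ p q (λ x∈p x∈q → disj (there x∈p) (there x∈q))

PairwiseDisjoint : ∀ {n} → List (Subset n) → Set
PairwiseDisjoint 𝒦 = ∀ {K M x} → K ∈ˡ 𝒦 → M ∈ˡ 𝒦 → K ≢ M → x ∈ K → x ∉ M

sum-∣∣≡∣⋃∣ : ∀ {n} (𝒦 : List (Subset n)) → Unique 𝒦 → PairwiseDisjoint 𝒦 →
  sum (map ∣_∣ 𝒦) ≡ ∣ ⋃ 𝒦 ∣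
sum-∣∣≡∣⋃∣ {n} [] _ _ = sym (∣⊥∣≡0 n)
sum-∣∣≡∣⋃∣ (K ∷ 𝒦) (K∉𝒦 ∷ unique) disj = trans
  (cong (∣ K ∣ +_) (sum-∣∣≡∣⋃∣ 𝒦 unique (λ K∈ M∈ → disj (there K∈) (there M∈))))
  (sym (∣p∪q∣≡∣p∣+∣q∣ K (⋃ 𝒦) K∩⋃𝒦≡∅))
  where
  K∩⋃𝒦≡∅ : ∀ {x} → x ∈ K → x ∉ ⋃ 𝒦
  K∩⋃𝒦≡∅ x∈K x∈⋃𝒦 with x∈⋃⁻ 𝒦 x∈⋃𝒦
  ... | M , M∈𝒦 , x∈M = disj (here refl) (there M∈𝒦) (All.lookup K∉𝒦 M∈𝒦) x∈K x∈M

fromDec : ∀ {n} {P : Fin n → Set} → Decidable P → Subset n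
fromDec P? = tabulate (does ∘ P?)

module _ {n} {P : Fin n → Set} (P? : Decidable P) where

  x∈fromDec⁺ : ∀ {x} → P x → x ∈ fromDec P?
  x∈fromDec⁺ {x} Px = lookup⇒[]= x _ (trans (lookup∘tabulate _ x) (dec-true (P? x) Px))

  x∈fromDec⁻ : ∀ {x} → x ∈ fromDec P? → P x
  x∈fromDec⁻ {x} x∈ with P? x | trans (sym (lookup∘tabulate (does ∘ P?) x)) ([]=⇒lookup x∈)
  ... | yes Px | _ = Px
  ... | no _   | ()

elements : ∀ {n} → Subset n → List (Fin n)
elements {n} K = filter (_∈? K) (allFin n)

∈-elements : ∀ {n} {K : Subset n} {x} → x ∈ K → x ∈ˡ elements K
∈-elements {K = K} x∈K = ∈-filter⁺ (_∈? K) (∈-allFin _) x∈K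

∃-minimiser : ∀ {n} {K : Subset n} (f : Fin n → ℕ) → Nonempty K →
  ∃[ v ] (v ∈ K × ∀ {w} → w ∈ K → f v ≤ f w)
∃-minimiser {n} {K} f (x₀ , x₀∈K) =
  argmin f x₀ (elements K) ,
  argmin-all f x₀∈K (all-filter (_∈? K) (allFin n)) ,
  All.lookup (f[argmin]≤f[xs] x₀ (elements K)) ∘ ∈-elements

∃-maximiser : ∀ {n} {K : Subset n} (f : Fin n → ℕ) → Nonempty K →
  ∃[ u ] (u ∈ K × ∀ {w} → w ∈ K → f w ≤ f u)
∃-maximiser {n} {K} f (x₀ , x₀∈K) =
  argmax f x₀ (elements K) ,
  argmax-all f x₀∈K (all-filter (_∈? K) (allFin n)) ,
  All.lookup (f[xs]≤f[argmax] x₀ (elements K)) ∘ ∈-elements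

Saturated : ∀ {n} → (Subset n → Set) → Subset n → Set
Saturated P S = ∀ w → P (S ∪ ⁅ w ⁆) → w ∈ S

∪⁅⁆-⊆ : ∀ {n} {S T : Subset n} {w} → S ⊆ T → w ∈ T → S ∪ ⁅ w ⁆ ⊆ T
∪⁅⁆-⊆ {S = S} {w = w} S⊆T w∈T x∈ with x∈p∪q⁻ S ⁅ w ⁆ x∈
... | inj₁ x∈S = S⊆T x∈S
... | inj₂ x∈⁅w⁆ = subst (_∈ _) (sym (x∈⁅y⁆⇒x≡y w x∈⁅w⁆)) w∈T

w∈S∪⁅w⁆ : ∀ {n} (S : Subset n) w → w ∈ S ∪ ⁅ w ⁆
w∈S∪⁅w⁆ S w = x∈p∪q⁺ (inj₂ (x∈⁅x⁆ w))

maximum⇒saturated : ∀ {n} {P : Subset n → Set} {S} →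
  (∀ T → P T → ∣ T ∣ ≤ ∣ S ∣) → Saturated P S
maximum⇒saturated {S = S} maximum w PS∪w with w ∈? S
... | yes w∈S = w∈S
... | no w∉S = ⊥-elim (<⇒≱ (p⊂q⇒∣p∣<∣q∣ S⊂S∪w) (maximum _ PS∪w))
  where
  S⊂S∪w : S ⊂ S ∪ ⁅ w ⁆
  S⊂S∪w = p⊆p∪q ⁅ w ⁆ , w , w∈S∪⁅w⁆ S w , w∉S

-- Greedy saturation: offer every vertex once; later insertions cannot re-enable an earlier
-- rejected vertex because P is closed under subsets.
module _ {n} {P : Subset n → Set} (P? : Decidable P) (P-⊆ : ∀ {A B} → A ⊆ B → P B → P A) where

  private
    insert? : Subset n → Fin n → Subset n
    insert? S w with P? (S ∪ ⁅ w ⁆)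
    ... | yes _ = S ∪ ⁅ w ⁆
    ... | no _  = S

    ⊆-insert? : ∀ S w → S ⊆ insert? S w
    ⊆-insert? S w with P? (S ∪ ⁅ w ⁆)
    ... | yes _ = p⊆p∪q ⁅ w ⁆
    ... | no _  = λ x∈S → x∈S

    P-insert? : ∀ S w → P S → P (insert? S w)
    P-insert? S w PS with P? (S ∪ ⁅ w ⁆)
    ... | yes PS∪w = PS∪w
    ... | no _     = PS

    ⊆-foldl : ∀ ws S → S ⊆ foldl insert? S ws
    ⊆-foldl []       S = λ x∈S → x∈S
    ⊆-foldl (w ∷ ws) S = ⊆-foldl ws _ ∘ ⊆-insert? S w

    P-foldl : ∀ ws S → P S → P (foldl insert? S ws)
    P-foldl []       S PS = PS
    P-foldl (w ∷ ws) S PS = P-foldl ws _ (P-insert? S w PS)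

    foldl-saturated : ∀ ws S w → w ∈ˡ ws → P (foldl insert? S ws ∪ ⁅ w ⁆) → w ∈ foldl insert? S ws
    foldl-saturated (w ∷ ws) S w (here refl) PT∪w with P? (S ∪ ⁅ w ⁆)
    ... | yes _   = ⊆-foldl ws _ (w∈S∪⁅w⁆ S w)
    ... | no ¬PS∪w = ⊥-elim (¬PS∪w (P-⊆ (∪⁅⁆-⊆ (p⊆p∪q ⁅ w ⁆ ∘ ⊆-foldl ws S) (w∈S∪⁅w⁆ _ w)) PT∪w))
    foldl-saturated (_ ∷ ws) S w (there w∈ws) PT∪w = foldl-saturated ws _ w w∈ws PT∪w

  ∃-saturated-⊇ : ∀ {S} → P S → ∃[ T ] (S ⊆ T × P T × Saturated P T)
  ∃-saturated-⊇ {S} PS =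
    foldl insert? S (allFin n) , ⊆-foldl (allFin n) S , P-foldl (allFin n) S PS ,
    λ w → foldl-saturated (allFin n) S w (∈-allFin w)

module Interval {n : ℕ} (I : IntervalRep n) where
  open IntervalRep I

  Adj-sym : ∀ {u v} → Adj I u v → Adj I v u
  Adj-sym (u≢v , lu≤rv , lv≤ru) = u≢v ∘ sym , lv≤ru , lu≤rv

  Adj? : ∀ u v → Dec (Adj I u v)
  Adj? u v = ¬? (u ≟ v) ×-dec l u ≤? r v ×-dec l v ≤? r u

  Dist2-sym : ∀ {u v} → Dist2 I u v → Dist2 I v u
  Dist2-sym (u≢v , ¬uv , z , uz , zv) = u≢v ∘ sym , ¬uv ∘ Adj-sym , z , Adj-sym zv , Adj-sym uz

  Adj⁼ : Fin n → Fin n → Set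
  Adj⁼ = ReflClosure (Adj I)

  Adj⁼-sym : ∀ {u v} → Adj⁼ u v → Adj⁼ v u
  Adj⁼-sym = ReflClosure.sym Adj-sym

  Adj⁼? : ∀ u v → Dec (Adj⁼ u v)
  Adj⁼? = ReflClosure.dec _≟_ Adj?

  Adj⁼⇒meets : ∀ {u v} → Adj⁼ u v → l u ≤ r v × l v ≤ r u
  Adj⁼⇒meets {u} refl = l≤r u , l≤r u
  Adj⁼⇒meets [ _ , lu≤rv , lv≤ru ] = lu≤rv , lv≤ru

  meets⇒Adj⁼ : ∀ {u v} → l u ≤ r v → l v ≤ r u → Adj⁼ u v
  meets⇒Adj⁼ {u} {v} lu≤rv lv≤ru with u ≟ v
  ... | yes refl = refl
  ... | no u≢v   = [ u≢v , lu≤rv , lv≤ru ]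

  Adj⁼⇒Adj : ∀ {u v} → Adj⁼ u v → u ≢ v → Adj I u v
  Adj⁼⇒Adj refl    u≢u = ⊥-elim (u≢u refl)
  Adj⁼⇒Adj [ uv ] _   = uv

  clique⇒Adj⁼ : ∀ {K u v} → IsClique I K → u ∈ K → v ∈ K → Adj⁼ u v
  clique⇒Adj⁼ {u = u} {v} cK u∈K v∈K with u ≟ v
  ... | yes refl = refl
  ... | no u≢v   = [ cK u v u∈K v∈K u≢v ]

  Adj⁼-trans : ∀ {S a b c} → IsSeparatedCluster I S → a ∈ S → c ∈ S →
    Adj⁼ a b → Adj⁼ b c → Adj⁼ a c
  Adj⁼-trans _ _ _ refl bc = bc
  Adj⁼-trans _ _ _ [ ab ] refl = [ ab ]
  Adj⁼-trans {a = a} {b} {c} sepS a∈S c∈S [ ab ] [ bc ] with Adj⁼? a c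
  ... | yes ac = ac
  ... | no ¬ac = ⊥-elim (sepS a c a∈S c∈S (a≢c , ¬ac ∘ [_] , b , ab , bc))
    where
    a≢c : a ≢ c
    a≢c refl = ¬ac refl

  -- z cannot fit into the gap between r v and l u, which is empty because v and u meet.
  neighbour-meets-ends : ∀ {v u w z} → Adj⁼ v u → l v ≤ l w → r w ≤ r u → Adj I w z →
    Adj⁼ v z ⊎ Adj⁼ u z
  neighbour-meets-ends {v} {u} {w} {z} vu lv≤lw rw≤ru (_ , lw≤rz , lz≤rw) with l z ≤? r v
  ... | yes lz≤rv = inj₁ (meets⇒Adj⁼ (≤-trans lv≤lw lw≤rz) lz≤rv)
  ... | no lz≰rv  = inj₂ (meets⇒Adj⁼ lu≤rz (≤-trans lz≤rw rw≤ru))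
    where
    lu≤rz : l u ≤ r z
    lu≤rz = ≤-trans (proj₂ (Adj⁼⇒meets vu)) (≤-trans (<⇒≤ (≰⇒> lz≰rv)) (l≤r z))

  separated? : Decidable (IsSeparatedCluster I)
  separated? S = all? λ u → all? λ v → u ∈? S →-dec v ∈? S →-dec
    ¬? (¬? (u ≟ v) ×-dec ¬? (Adj? u v) ×-dec any? λ z → Adj? u z ×-dec Adj? z v)

  clique? : Decidable (IsClique I)
  clique? S = all? λ u → all? λ v → u ∈? S →-dec v ∈? S →-dec ¬? (u ≟ v) →-dec Adj? u v

  separated-⊆ : ∀ {A B} → A ⊆ B → IsSeparatedCluster I B → IsSeparatedCluster I A
  separated-⊆ A⊆B sepB u v u∈A v∈A = sepB u v (A⊆B u∈A) (A⊆B v∈A)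

  clique-⊆ : ∀ {A B} → A ⊆ B → IsClique I B → IsClique I A
  clique-⊆ A⊆B cB u v u∈A v∈A = cB u v (A⊆B u∈A) (A⊆B v∈A)

  separated-∪⁅⁆ : ∀ {S w} → IsSeparatedCluster I S → (∀ b → b ∈ S → ¬ Dist2 I w b) →
    IsSeparatedCluster I (S ∪ ⁅ w ⁆)
  separated-∪⁅⁆ {S} {w} sepS w-far a c a∈ c∈ with x∈p∪q⁻ S ⁅ w ⁆ a∈ | x∈p∪q⁻ S ⁅ w ⁆ c∈
  ... | inj₁ a∈S | inj₁ c∈S = sepS a c a∈S c∈S
  ... | inj₂ a≡w | inj₁ c∈S rewrite x∈⁅y⁆⇒x≡y w a≡w = w-far c c∈S
  ... | inj₁ a∈S | inj₂ c≡w rewrite x∈⁅y⁆⇒x≡y w c≡w = w-far a a∈S ∘ Dist2-sym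
  ... | inj₂ a≡w | inj₂ c≡w rewrite x∈⁅y⁆⇒x≡y w a≡w | x∈⁅y⁆⇒x≡y w c≡w = λ d → proj₁ d refl

  saturated-clique⇒maximal : ∀ {C} → IsClique I C → Saturated (IsClique I) C → IsMaximalClique I C
  saturated-clique⇒maximal cC satC = cC , λ D cD C⊆D x∈D → satC _ (clique-⊆ (∪⁅⁆-⊆ C⊆D x∈D) cD)

  reach-⊆ : ∀ {X Y a b} → X ⊆ Y → Reach I X a b → Reach I Y a b
  reach-⊆ X⊆Y (here a∈X) = here (X⊆Y a∈X)
  reach-⊆ X⊆Y (step ra w∈X vw) = step (reach-⊆ X⊆Y ra) (X⊆Y w∈X) vw

  reach-++ : ∀ {X a b c} → Reach I X a b → Reach I X b c → Reach I X a c
  reach-++ rab (here _) = rab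
  reach-++ rab (step rbv w∈X vw) = step (reach-++ rab rbv) w∈X vw

  clique⇒connected : ∀ {K} → IsClique I K → IsConnected I K
  clique⇒connected cK a b a∈K b∈K with clique⇒Adj⁼ cK a∈K b∈K
  ... | refl   = here a∈K
  ... | [ ab ] = step (here a∈K) b∈K ab

  connected-∪⁅⁆ : ∀ {X x y} → IsConnected I X → x ∈ X → Adj I x y → IsConnected I (X ∪ ⁅ y ⁆)
  connected-∪⁅⁆ {X} {x} {y} conX x∈X xy a b a∈ b∈ =
    reach (map₂ (x∈⁅y⁆⇒x≡y y) (x∈p∪q⁻ X ⁅ y ⁆ a∈)) (map₂ (x∈⁅y⁆⇒x≡y y) (x∈p∪q⁻ X ⁅ y ⁆ b∈))
    where
    within : ∀ {a b} → Reach I X a b → Reach I (X ∪ ⁅ y ⁆) a b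
    within = reach-⊆ (p⊆p∪q ⁅ y ⁆)
    y∈ : y ∈ X ∪ ⁅ y ⁆
    y∈ = w∈S∪⁅w⁆ X y
    reach : ∀ {a b} → a ∈ X ⊎ a ≡ y → b ∈ X ⊎ b ≡ y → Reach I (X ∪ ⁅ y ⁆) a b
    reach (inj₁ a∈X) (inj₁ b∈X) = within (conX _ _ a∈X b∈X)
    reach (inj₁ a∈X) (inj₂ refl) = step (within (conX _ x a∈X x∈X)) y∈ xy
    reach (inj₂ refl) (inj₁ b∈X) =
      reach-++ (step (here y∈) (p⊆p∪q ⁅ y ⁆ x∈X) (Adj-sym xy)) (within (conX x _ x∈X b∈X))
    reach (inj₂ refl) (inj₂ refl) = here y∈

  record CliqueComponents (S : Subset n) (𝒦 : List (Subset n)) : Set where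
    field
      unique   : Unique 𝒦
      clique   : ∀ {K} → K ∈ˡ 𝒦 → IsClique I K
      nonempty : ∀ {K} → K ∈ˡ 𝒦 → Nonempty K
      ⊆S       : ∀ {K} → K ∈ˡ 𝒦 → K ⊆ S
      cover    : ∀ {x} → x ∈ S → ∃[ K ] (K ∈ˡ 𝒦 × x ∈ K)
      closed   : ∀ {K x y} → K ∈ˡ 𝒦 → x ∈ K → y ∈ S → Adj I x y → y ∈ K
      disjoint : PairwiseDisjoint 𝒦

  module _ {S 𝒦} (𝒞 : CliqueComponents S 𝒦) where
    open CliqueComponents 𝒞

    closed⁼ : ∀ {K x y} → K ∈ˡ 𝒦 → x ∈ K → y ∈ S → Adj⁼ x y → y ∈ K
    closed⁼ _   x∈K _   refl   = x∈K
    closed⁼ K∈𝒦 x∈K y∈S [ xy ] = closed K∈𝒦 x∈K y∈S xy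

    components-weight : weight I 𝒦 ≡ ∣ S ∣
    components-weight = trans (sum-∣∣≡∣⋃∣ 𝒦 unique disjoint) (cong ∣_∣ ⋃𝒦≡S)
      where
      ⋃𝒦≡S : ⋃ 𝒦 ≡ S
      ⋃𝒦≡S = ⊆-antisym
        (λ x∈⋃𝒦 → let K , K∈𝒦 , x∈K = x∈⋃⁻ 𝒦 x∈⋃𝒦 in ⊆S K∈𝒦 x∈K)
        (λ x∈S → let K , K∈𝒦 , x∈K = cover x∈S in ⊆⋃ K∈𝒦 x∈K)

    reach-closed : ∀ {K X a b} → K ∈ˡ 𝒦 → X ⊆ S → Reach I X a b → a ∈ K → b ∈ K
    reach-closed K∈𝒦 X⊆S (here _) a∈K = a∈K
    reach-closed K∈𝒦 X⊆S (step rav w∈X vw) a∈K =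
      closed K∈𝒦 (reach-closed K∈𝒦 X⊆S rav a∈K) (X⊆S w∈X) vw

    components-∈⇔IsComponent : ∀ X → (X ∈ˡ 𝒦) ⇔ IsComponent I S X
    components-∈⇔IsComponent X = mk⇔ component member
      where
      component : X ∈ˡ 𝒦 → IsComponent I S X
      component X∈𝒦 = ⊆S X∈𝒦 , nonempty X∈𝒦 , clique⇒connected (clique X∈𝒦) ,
        λ Y X⊆Y Y⊆S conY y∈Y → let x , x∈X = nonempty X∈𝒦 in
          reach-closed X∈𝒦 Y⊆S (conY x _ (X⊆Y x∈X) y∈Y) x∈X
      member : IsComponent I S X → X ∈ˡ 𝒦
      member (X⊆S , (x , x∈X) , conX , maxX) with cover (X⊆S x∈X)
      ... | M , M∈𝒦 , x∈M = subst (_∈ˡ 𝒦) (⊆-antisym M⊆X X⊆M) M∈𝒦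
        where
        X⊆M : X ⊆ M
        X⊆M y∈X = reach-closed M∈𝒦 X⊆S (conX x _ x∈X y∈X) x∈M
        M⊆X : M ⊆ X
        M⊆X = maxX M X⊆M (⊆S M∈𝒦) (clique⇒connected (clique M∈𝒦))

    -- Each way of being adjacent in G_c would put a vertex of K₂ into K₁.
    components-¬AdjC : IsSeparatedCluster I S → ∀ {K₁ K₂} → K₁ ∈ˡ 𝒦 → K₂ ∈ˡ 𝒦 → ¬ AdjC I K₁ K₂
    components-¬AdjC _ {K₁} {K₂} K₁∈𝒦 K₂∈𝒦 (K₁≢K₂ , inj₁ (x , x∈K₁∩K₂)) =
      uncurry (disjoint K₁∈𝒦 K₂∈𝒦 K₁≢K₂) (x∈p∩q⁻ K₁ K₂ x∈K₁∩K₂)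
    components-¬AdjC _ K₁∈𝒦 K₂∈𝒦 (K₁≢K₂ , inj₂ (inj₁ (x , y , x∈K₁ , y∈K₂ , xy))) =
      disjoint K₁∈𝒦 K₂∈𝒦 K₁≢K₂ (closed K₁∈𝒦 x∈K₁ (⊆S K₂∈𝒦 y∈K₂) xy) y∈K₂
    components-¬AdjC sepS K₁∈𝒦 K₂∈𝒦 (K₁≢K₂ , inj₂ (inj₂ (x , y , z , x∈K₁ , y∈K₂ , _ , zx , zy))) =
      disjoint K₁∈𝒦 K₂∈𝒦 K₁≢K₂ (closed⁼ K₁∈𝒦 x∈K₁ y∈S xy) y∈K₂
      where
      y∈S : y ∈ S
      y∈S = ⊆S K₂∈𝒦 y∈K₂
      xy : Adj⁼ x y
      xy = Adj⁼-trans sepS (⊆S K₁∈𝒦 x∈K₁) y∈S [ Adj-sym zx ] [ zy ]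

    component-InĈ : IsSeparatedCluster I S → Saturated (IsSeparatedCluster I) S →
      ∀ {K} → K ∈ˡ 𝒦 → InĈ I K
    component-InĈ sepS satS {K} K∈𝒦
      with ∃-saturated-⊇ clique? clique-⊆ (clique K∈𝒦)
         | ∃-minimiser l (nonempty K∈𝒦) | ∃-maximiser r (nonempty K∈𝒦)
    ... | C , K⊆C , cC , satC | v , v∈K , v-first | u , u∈K , u-last =
      C , (saturated-clique⇒maximal cC satC , v , u , K⊆C v∈K , K⊆C u∈K ,
           λ w → mk⇔ (λ w∈K → K⊆C w∈K , v-first w∈K , u-last w∈K)
                     (λ (w∈C , lv≤lw , rw≤ru) → between⇒∈K w∈C lv≤lw rw≤ru)) ,
          nonempty K∈𝒦
      where
      far : ∀ {w} → w ∈ C → l v ≤ l w → r w ≤ r u → ∀ b → b ∈ S → ¬ Dist2 I w b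
      far {w} w∈C lv≤lw rw≤ru b b∈S (w≢b , ¬wb , z , wz , zb) =
        [ reaches-b v∈K , reaches-b u∈K ]′
          (neighbour-meets-ends (clique⇒Adj⁼ (clique K∈𝒦) v∈K u∈K) lv≤lw rw≤ru wz)
        where
        reaches-b : ∀ {k} → k ∈ K → ¬ Adj⁼ k z
        reaches-b k∈K kz = ¬wb (cC w b w∈C (K⊆C b∈K) w≢b)
          where
          b∈K : b ∈ K
          b∈K = closed⁼ K∈𝒦 k∈K b∈S (Adj⁼-trans sepS (⊆S K∈𝒦 k∈K) b∈S kz [ zb ])
      between⇒∈K : ∀ {w} → w ∈ C → l v ≤ l w → r w ≤ r u → w ∈ K
      between⇒∈K w∈C lv≤lw rw≤ru = closed⁼ K∈𝒦 v∈K
        (satS _ (separated-∪⁅⁆ sepS (far w∈C lv≤lw rw≤ru)))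
        (clique⇒Adj⁼ cC (K⊆C v∈K) w∈C)

    components-indep : IsSeparatedCluster I S → Saturated (IsSeparatedCluster I) S → IsIndepC I 𝒦
    components-indep sepS satS =
      unique , (λ _ → component-InĈ sepS satS) , λ _ _ → components-¬AdjC sepS

  -- The components are the classes of Adj⁼, an equivalence relation on a separated-cluster.
  separated⇒components : ∀ {T} → IsSeparatedCluster I T → ∃[ 𝒯 ] CliqueComponents T 𝒯
  separated⇒components {T} sepT = 𝒯 , record
    { unique   = Unique.deduplicate-! _≟ˢ_ (map N (elements T))
    ; clique   = clique
    ; nonempty = nonempty
    ; ⊆S       = ⊆T
    ; cover    = λ {x} x∈T → N x , 𝒯⁺ x∈T , N⁺ x x∈T refl
    ; closed   = closed
    ; disjoint = disjoint
    }
    where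
    N : Fin n → Subset n
    N x = fromDec (λ y → y ∈? T ×-dec Adj⁼? x y)
    N⁺ : ∀ x {y} → y ∈ T → Adj⁼ x y → y ∈ N x
    N⁺ x y∈T xy = x∈fromDec⁺ (λ y → y ∈? T ×-dec Adj⁼? x y) (y∈T , xy)
    N⁻ : ∀ x {y} → y ∈ N x → y ∈ T × Adj⁼ x y
    N⁻ x = x∈fromDec⁻ (λ y → y ∈? T ×-dec Adj⁼? x y)
    N-⊆ : ∀ {x x′ z} → x ∈ T → x′ ∈ T → z ∈ N x → z ∈ N x′ → N x ⊆ N x′
    N-⊆ {x} {x′} x∈T x′∈T z∈Nx z∈Nx′ y∈Nx = let y∈T , xy = N⁻ x y∈Nx in
      N⁺ x′ y∈T (Adj⁼-trans sepT x′∈T y∈T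
        (Adj⁼-trans sepT x′∈T x∈T (proj₂ (N⁻ x′ z∈Nx′)) (Adj⁼-sym (proj₂ (N⁻ x z∈Nx)))) xy)

    𝒯 : List (Subset n)
    𝒯 = deduplicate _≟ˢ_ (map N (elements T))
    𝒯⁻ : ∀ {K} → K ∈ˡ 𝒯 → ∃[ x ] (x ∈ T × K ≡ N x)
    𝒯⁻ K∈𝒯 with ∈-map⁻ N (∈-deduplicate⁻ _≟ˢ_ (map N (elements T)) K∈𝒯)
    ... | x , x∈T , K≡Nx = x , proj₂ (∈-filter⁻ (_∈? T) {xs = allFin n} x∈T) , K≡Nx
    𝒯⁺ : ∀ {x} → x ∈ T → N x ∈ˡ 𝒯
    𝒯⁺ x∈T = ∈-deduplicate⁺ _≟ˢ_ (∈-map⁺ N (∈-elements x∈T))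

    nonempty : ∀ {K} → K ∈ˡ 𝒯 → Nonempty K
    nonempty K∈𝒯 with 𝒯⁻ K∈𝒯
    ... | x , x∈T , refl = x , N⁺ _ x∈T refl
    ⊆T : ∀ {K} → K ∈ˡ 𝒯 → K ⊆ T
    ⊆T K∈𝒯 y∈K with 𝒯⁻ K∈𝒯
    ... | x , x∈T , refl = proj₁ (N⁻ x y∈K)
    clique : ∀ {K} → K ∈ˡ 𝒯 → IsClique I K
    clique K∈𝒯 a b a∈K b∈K a≢b with 𝒯⁻ K∈𝒯
    ... | x , x∈T , refl = let a∈T , xa = N⁻ x a∈K ; b∈T , xb = N⁻ x b∈K in
      Adj⁼⇒Adj (Adj⁼-trans sepT a∈T b∈T (Adj⁼-sym xa) xb) a≢b
    closed : ∀ {K k y} → K ∈ˡ 𝒯 → k ∈ K → y ∈ T → Adj I k y → y ∈ K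
    closed K∈𝒯 k∈K y∈T ky with 𝒯⁻ K∈𝒯
    ... | x , x∈T , refl = N⁺ x y∈T (Adj⁼-trans sepT x∈T y∈T (proj₂ (N⁻ x k∈K)) [ ky ])
    disjoint : PairwiseDisjoint 𝒯
    disjoint K∈𝒯 M∈𝒯 K≢M z∈K z∈M with 𝒯⁻ K∈𝒯 | 𝒯⁻ M∈𝒯
    ... | x , x∈T , refl | x′ , x′∈T , refl =
      K≢M (⊆-antisym (N-⊆ x∈T x′∈T z∈K z∈M) (N-⊆ x′∈T x∈T z∈M z∈K))

  InĈ⇒clique : ∀ {K} → InĈ I K → IsClique I K
  InĈ⇒clique (C , ((cC , _) , _ , _ , _ , _ , K⇔) , _) a b a∈K b∈K =
    cC a b (proj₁ (Equivalence.to (K⇔ a) a∈K)) (proj₁ (Equivalence.to (K⇔ b) b∈K))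

  indep⇒separated : ∀ {𝒯} → IsIndepC I 𝒯 → IsSeparatedCluster I (⋃ 𝒯)
  indep⇒separated {𝒯} (_ , inĈ , ¬adj) a b a∈ b∈ (a≢b , ¬ab , z , az , zb)
    with x∈⋃⁻ 𝒯 a∈ | x∈⋃⁻ 𝒯 b∈
  ... | K₁ , K₁∈𝒯 , a∈K₁ | K₂ , K₂∈𝒯 , b∈K₂ with K₁ ≟ˢ K₂
  ...   | yes refl = ¬ab (InĈ⇒clique (inĈ K₁ K₁∈𝒯) a b a∈K₁ b∈K₂ a≢b)
  ...   | no K₁≢K₂ = ¬adj K₁ K₂ K₁∈𝒯 K₂∈𝒯 (adjacent (z ∈? K₁) (z ∈? K₂))
    where
    adjacent : Dec (z ∈ K₁) → Dec (z ∈ K₂) → AdjC I K₁ K₂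
    adjacent (yes z∈K₁) _ = K₁≢K₂ , inj₂ (inj₁ (z , b , z∈K₁ , b∈K₂ , zb))
    adjacent (no _) (yes z∈K₂) = K₁≢K₂ , inj₂ (inj₁ (a , z , a∈K₁ , z∈K₂ , az))
    adjacent (no z∉K₁) (no z∉K₂) = K₁≢K₂ , inj₂ (inj₂
      (a , b , z , a∈K₁ , b∈K₂ , [ z∉K₁ , z∉K₂ ]′ ∘ x∈p∪q⁻ K₁ K₂ , Adj-sym az , zb))

  indep⇒components : ∀ {𝒯} → IsIndepC I 𝒯 → CliqueComponents (⋃ 𝒯) 𝒯
  indep⇒components {𝒯} (unique , inĈ , ¬adj) = record
    { unique   = unique
    ; clique   = λ {K} K∈𝒯 → InĈ⇒clique (inĈ K K∈𝒯)
    ; nonempty = λ {K} K∈𝒯 → proj₂ (proj₂ (inĈ K K∈𝒯))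
    ; ⊆S       = ⊆⋃
    ; cover    = x∈⋃⁻ 𝒯
    ; closed   = closed
    ; disjoint = λ K∈𝒯 M∈𝒯 K≢M x∈K x∈M →
        ¬adj _ _ K∈𝒯 M∈𝒯 (K≢M , inj₁ (_ , x∈p∩q⁺ (x∈K , x∈M)))
    }
    where
    closed : ∀ {K x y} → K ∈ˡ 𝒯 → x ∈ K → y ∈ ⋃ 𝒯 → Adj I x y → y ∈ K
    closed {K} K∈𝒯 x∈K y∈ xy with x∈⋃⁻ 𝒯 y∈
    ... | M , M∈𝒯 , y∈M with K ≟ˢ M
    ...   | yes refl = y∈M
    ...   | no K≢M   = ⊥-elim (¬adj K M K∈𝒯 M∈𝒯 (K≢M , inj₂ (inj₁ (_ , _ , x∈K , y∈M , xy))))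

  indep-weight : ∀ {𝒯} → IsIndepC I 𝒯 → weight I 𝒯 ≡ ∣ ⋃ 𝒯 ∣
  indep-weight = components-weight ∘ indep⇒components

  separated⇒dominated : ∀ {T} → IsSeparatedCluster I T → ∃[ 𝒯 ] (IsIndepC I 𝒯 × ∣ T ∣ ≤ weight I 𝒯)
  separated⇒dominated {T} sepT with ∃-saturated-⊇ separated? separated-⊆ sepT
  ... | T′ , T⊆T′ , sepT′ , satT′ with separated⇒components sepT′
  ...   | 𝒯 , 𝒞 = 𝒯 , components-indep 𝒞 sepT′ satT′ ,
      subst (∣ T ∣ ≤_) (sym (components-weight 𝒞)) (p⊆q⇒∣p∣≤∣q∣ T⊆T′)

  component-closed : ∀ {U X x y} → IsComponent I U X → x ∈ X → y ∈ U → Adj I x y → y ∈ X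
  component-closed {X = X} {y = y} (X⊆U , _ , conX , maxX) x∈X y∈U xy =
    maxX _ (p⊆p∪q ⁅ y ⁆) (∪⁅⁆-⊆ X⊆U y∈U) (connected-∪⁅⁆ conX x∈X xy) (w∈S∪⁅w⁆ X y)

  components⇒CliqueComponents : ∀ {𝒮} → Unique 𝒮 → PairwiseDisjointCliques I 𝒮 →
    (∀ X → (X ∈ˡ 𝒮) ⇔ IsComponent I (⋃ 𝒮) X) → CliqueComponents (⋃ 𝒮) 𝒮
  components⇒CliqueComponents {𝒮} unique (cliques , disjoint) X∈⇔ = record
    { unique   = unique
    ; clique   = λ {K} → cliques K
    ; nonempty = λ K∈𝒮 → proj₁ (proj₂ (component K∈𝒮))
    ; ⊆S       = ⊆⋃
    ; cover    = x∈⋃⁻ 𝒮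
    ; closed   = λ K∈𝒮 → component-closed (component K∈𝒮)
    ; disjoint = λ K∈𝒮 M∈𝒮 K≢M x∈K x∈M → disjoint _ _ K∈𝒮 M∈𝒮 K≢M (_ , x∈p∩q⁺ (x∈K , x∈M))
    }
    where
    component : ∀ {K} → K ∈ˡ 𝒮 → IsComponent I (⋃ 𝒮) K
    component {K} = Equivalence.to (X∈⇔ K)

theorem13 : (n : ℕ) (I : IntervalRep n) (𝒮 : List (Subset n)) →
    Unique 𝒮 → PairwiseDisjointCliques I 𝒮 →
    IsMaxSepClusterFamily I 𝒮 ⇔ IsMaxWeightIndepC I 𝒮
theorem13 n I 𝒮 unique disjoint-cliques = mk⇔ to from
  where
  open Interval I

  to : IsMaxSepClusterFamily I 𝒮 → IsMaxWeightIndepC I 𝒮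
  to ((sep𝒮 , maximum) , components) =
    components-indep 𝒞 sep𝒮 (maximum⇒saturated maximum) ,
    λ 𝒯 indep-𝒯 → subst₂ _≤_ (sym (indep-weight indep-𝒯)) (sym (components-weight 𝒞))
                             (maximum (⋃ 𝒯) (indep⇒separated indep-𝒯))
    where
    𝒞 : CliqueComponents (⋃ 𝒮) 𝒮
    𝒞 = components⇒CliqueComponents unique disjoint-cliques components

  from : IsMaxWeightIndepC I 𝒮 → IsMaxSepClusterFamily I 𝒮
  from (indep-𝒮 , heaviest) =
    (indep⇒separated indep-𝒮 , maximum) , components-∈⇔IsComponent (indep⇒components indep-𝒮)
    where
    maximum : ∀ T → IsSeparatedCluster I T → ∣ T ∣ ≤ ∣ ⋃ 𝒮 ∣
    maximum T sepT =
      let 𝒯 , indep-𝒯 , ∣T∣≤w𝒯 = separated⇒dominated sepT in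
      ≤-trans ∣T∣≤w𝒯 (subst (weight I 𝒯 ≤_) (indep-weight indep-𝒮) (heaviest 𝒯 indep-𝒯))
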